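{- Let $k\ge1$ and $n\ge0$. Two plane trees with $n+1$ nodes are $k$-equivalent if and only if their multi-degrees are congruent modulo $k$ componentwise.
   Context: A binary tree is a rooted plane tree in which every node has $0$ or $2$ ordered children; $\mathcal T_n$ is the set of binary trees with $n+1$ leaves. For binary trees $s,t$, $s\wedge t$ has left subtree $s$ and right subtree $t$ at the root; iterated $\wedge$ is read left to right. A right $k$-rotation replaces a maximal subtree $(t_0\wedge\cdots\wedge t_k)\wedge t_{k+1}$ by $t_0\wedge(t_1\wedge\cdots\wedge t_{k+1})$; a left $k$-rotation is its inverse; two binary trees are $k$-equivalent if related by a finite sequence of such rotations. A plane tree is a rooted tree whose children at each node are linearly ordered; nodes are labelled $v_0,\dots,v_n$ in pre-order (root first, then recursively the subtrees of the root from left to right), and the multi-degree is $(d_0,\dots,d_n)$ with $d_i$ the number of children of $v_i$. The bijection $\Phi$ from binary trees with $n+1$ leaves to plane trees with $n+1$ nodes: $\Phi$(single leaf) is a single node, and $\Phi(s\wedge t)$ is obtained from $\Phi(s)$ by attaching $\Phi(t)$ as a new rightmost subtree of the root. Two plane trees are $k$-equivalent if their preimages under $\Phi$ are. -}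

module Defs where

open import Data.Nat using (ℕ; zero; suc; _+_; _%_; NonZero)
open import Data.List using (List; []; _∷_; _++_; foldl; length; concatMap; map)
open import Data.List.Relation.Binary.Pointwise using (Pointwise)
open import Relation.Binary.PropositionalEquality using (_≡_)
open import Relation.Binary.Construct.Closure.Equivalence using (EqClosure)
open import Data.Product using (Σ; _×_)

infixl 5 _∧_
data Bin : Set where
  leaf : Bin
  _∧_  : Bin → Bin → Bin

leaves : Bin → ℕ
leaves leaf    = 1
leaves (s ∧ t) = leaves s + leaves t

𝒯 : ℕ → Set
𝒯 n = Σ Bin λ t → leaves t ≡ suc n

-- iterated ∧ read left to right: t₀ ∧ t₁ ∧ ⋯ ∧ tₘ = (⋯(t₀ ∧ t₁) ∧ ⋯) ∧ tₘ
iter : Bin → List Bin → Bin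
iter t₀ ts = foldl _∧_ t₀ ts

-- t₁ ∧ ⋯ ∧ tₖ ∧ u  given the list [t₁,…,tₖ] and u
iterSnoc : List Bin → Bin → Bin
iterSnoc []         u = u
iterSnoc (t₁ ∷ ts)  u = iter t₁ (ts ++ u ∷ [])

-- One right k-rotation applied to some subtree:
-- (t₀ ∧ ⋯ ∧ tₖ) ∧ tₖ₊₁  ↦  t₀ ∧ (t₁ ∧ ⋯ ∧ tₖ₊₁)
data RightRot (k : ℕ) : Bin → Bin → Set where
  root  : (t₀ : Bin) (ts : List Bin) (u : Bin) → length ts ≡ k →
          RightRot k (iter t₀ ts ∧ u) (t₀ ∧ iterSnoc ts u)
  left  : ∀ {s s′} (t : Bin) → RightRot k s s′ → RightRot k (s ∧ t) (s′ ∧ t)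
  right : ∀ {t t′} (s : Bin) → RightRot k t t′ → RightRot k (s ∧ t) (s ∧ t′)

-- k-equivalence of binary trees: equivalence closure of right k-rotations
-- (left k-rotations are the inverses)
_≈[_]ᵇ_ : Bin → ℕ → Bin → Set
s ≈[ k ]ᵇ t = EqClosure (RightRot k) s t

data Plane : Set where
  node : List Plane → Plane

mutual
  nodes : Plane → ℕ
  nodes (node cs) = suc (nodesF cs)

  nodesF : List Plane → ℕ
  nodesF []       = 0
  nodesF (c ∷ cs) = nodes c + nodesF cs

PlaneTree : ℕ → Set
PlaneTree m = Σ Plane λ p → nodes p ≡ m

Φ : Bin → Plane
Φ leaf    = node []
Φ (s ∧ t) with Φ s
... | node cs = node (cs ++ Φ t ∷ [])

-- multi-degree (d₀,…,dₙ), nodes listed in pre-order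
mutual
  multiDegree : Plane → List ℕ
  multiDegree (node cs) = length cs ∷ multiDegreeF cs

  multiDegreeF : List Plane → List ℕ
  multiDegreeF []       = []
  multiDegreeF (c ∷ cs) = multiDegree c ++ multiDegreeF cs

_≈[_]ᵖ_ : Plane → ℕ → Plane → Set
p ≈[ k ]ᵖ q = Σ Bin λ s → Σ Bin λ t → Φ s ≡ p × Φ t ≡ q × s ≈[ k ]ᵇ t

CongMod : (k : ℕ) .{{_ : NonZero k}} → List ℕ → List ℕ → Set
CongMod k = Pointwise (λ a b → a % k ≡ b % k)

-- A right k-rotation moves the last k children of a node v below the child of
-- v just before them, so in pre-order the degree sequence changes only by −k at
-- v and +k at that child: rotations preserve degrees mod k. Conversely, through
-- rotations every node other than the root can hand ⌊d/k⌋·k of its d children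
-- over to its parent, which reaches a normal form where all non-root degrees
-- are < k. Its non-root degrees are then the residues of the original ones, its
-- root degree is forced by the number of nodes, and a plane tree is determined
-- by its degree sequence; so congruent trees of the same size have the same
-- normal form.
module Submission where

open import Defs
open import Data.Nat using (ℕ; zero; suc; _+_; _*_; _∸_; _%_; _/_; _≤_; _<_; NonZero; >-nonZero; ≢-nonZero⁻¹)
open import Data.Nat.Properties using (+-comm; +-assoc; +-suc; m+n∸m≡n; m≤m+n; m≤n⇒m⊓n≡m; +-cancelʳ-≡; suc-injective)
open import Data.Nat.DivMod using (m≡m%n+[m/n]*n; [m+n]%n≡m%n; m%n<n; m%n≤m; m<n⇒m%n≡m; %-distribˡ-+)
open import Data.Nat.ListAction using (sum)
open import Data.Nat.ListAction.Properties using (sum-++)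
open import Data.Nat.Solver using (module +-*-Solver)
open import Data.List using (List; []; _∷_; _++_; _∷ʳ_; length; map; take; drop; initLast; _∷ʳ′_)
open import Data.List.Properties using (++-assoc; ++-identityʳ; ∷-injective; foldl-++; foldl-∷ʳ; length-++; length-map; length-take; length-drop; take++drop≡id)
open import Data.List.Relation.Binary.Pointwise as Pointwise using (Pointwise; []; _∷_)
open import Data.List.Relation.Unary.All using (All; []; _∷_)
open import Data.List.Relation.Unary.All.Properties using (++⁺)
open import Data.Empty using (⊥-elim)
open import Data.Product using (_×_; _,_; proj₁)
open import Function using (_∘_)
open import Function.Bundles using (_⇔_; mk⇔)
open import Relation.Binary.Structures using (IsEquivalence)
import Relation.Binary.Construct.On as On
open import Relation.Binary.Construct.Closure.Equivalence using (gfold; gmap; setoid)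
open import Relation.Binary.Construct.Closure.Symmetric using (bwd)
open import Relation.Binary.Construct.Closure.ReflexiveTransitive using (ε; _◅_)
import Relation.Binary.Reasoning.Setoid as SetoidReasoning
open import Relation.Binary.PropositionalEquality
  using (_≡_; refl; sym; trans; cong; cong₂; subst; subst₂; isEquivalence; module ≡-Reasoning)

multiDegreeF-++ : ∀ cs ds → multiDegreeF (cs ++ ds) ≡ multiDegreeF cs ++ multiDegreeF ds
multiDegreeF-++ []       ds = refl
multiDegreeF-++ (c ∷ cs) ds =
  trans (cong (multiDegree c ++_) (multiDegreeF-++ cs ds))
        (sym (++-assoc (multiDegree c) (multiDegreeF cs) (multiDegreeF ds)))

nodesF-++ : ∀ cs ds → nodesF (cs ++ ds) ≡ nodesF cs + nodesF ds
nodesF-++ []       ds = refl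
nodesF-++ (c ∷ cs) ds = trans (cong (nodes c +_) (nodesF-++ cs ds)) (sym (+-assoc (nodes c) (nodesF cs) (nodesF ds)))

nodesF≡length+sum : ∀ cs → nodesF cs ≡ length cs + sum (multiDegreeF cs)
nodesF≡length+sum []              = refl
nodesF≡length+sum (node cs′ ∷ cs) = begin
  suc (nodesF cs′) + nodesF cs
    ≡⟨ cong₂ (λ a b → suc a + b) (nodesF≡length+sum cs′) (nodesF≡length+sum cs) ⟩
  suc (l′ + s′) + (l + s)
    ≡⟨ solve 4 (λ l′ s′ l s → con 1 :+ (l′ :+ s′) :+ (l :+ s) := con 1 :+ (l :+ (l′ :+ (s′ :+ s)))) refl l′ s′ l s ⟩
  suc (l + (l′ + (s′ + s)))
    ≡⟨ cong (λ x → suc (l + (l′ + x))) (sym (sum-++ (multiDegreeF cs′) (multiDegreeF cs))) ⟩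
  suc (l + (l′ + sum (multiDegreeF cs′ ++ multiDegreeF cs))) ∎
  where
  open ≡-Reasoning
  open +-*-Solver
  l′ = length cs′
  s′ = sum (multiDegreeF cs′)
  l  = length cs
  s  = sum (multiDegreeF cs)

mutual
  multiDegree-++-injective : ∀ p q {xs ys} → multiDegree p ++ xs ≡ multiDegree q ++ ys → p ≡ q × xs ≡ ys
  multiDegree-++-injective (node cs) (node ds) eq with ∷-injective eq
  ... | |cs|≡|ds| , tails with multiDegreeF-++-injective cs ds |cs|≡|ds| tails
  ...   | refl , xs≡ys = refl , xs≡ys

  multiDegreeF-++-injective : ∀ cs ds {xs ys} → length cs ≡ length ds →
    multiDegreeF cs ++ xs ≡ multiDegreeF ds ++ ys → cs ≡ ds × xs ≡ ys
  multiDegreeF-++-injective []       []       _ eq = refl , eq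
  multiDegreeF-++-injective (c ∷ cs) (d ∷ ds) {xs} {ys} |cs|≡|ds| eq
    with multiDegree-++-injective c d
           (trans (sym (++-assoc (multiDegree c) (multiDegreeF cs) xs))
                  (trans eq (++-assoc (multiDegree d) (multiDegreeF ds) ys)))
  ... | refl , tails with multiDegreeF-++-injective cs ds (suc-injective |cs|≡|ds|) tails
  ...   | refl , xs≡ys = refl , xs≡ys

-- The number of trees in a forest is its number of nodes minus the sum of the degrees.
multiDegreeF-injective : ∀ {cs ds} → nodesF cs ≡ nodesF ds → multiDegreeF cs ≡ multiDegreeF ds → cs ≡ ds
multiDegreeF-injective {cs} {ds} nodes≡ degrees≡ =
  proj₁ (multiDegreeF-++-injective cs ds |cs|≡|ds| (cong (_++ []) degrees≡))
  where
  |cs|≡|ds| : length cs ≡ length ds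
  |cs|≡|ds| = +-cancelʳ-≡ _ (length cs) (length ds)
    (trans (sym (nodesF≡length+sum cs))
      (trans nodes≡ (subst (λ x → nodesF ds ≡ length ds + sum x) (sym degrees≡) (nodesF≡length+sum ds))))

children : Bin → List Plane
children leaf    = []
children (s ∧ t) = children s ++ Φ t ∷ []

Φ≡node∘children : ∀ s → Φ s ≡ node (children s)
Φ≡node∘children leaf = refl
Φ≡node∘children (s ∧ t) rewrite Φ≡node∘children s = refl

children-iter : ∀ s ts → children (iter s ts) ≡ children s ++ map Φ ts
children-iter s []       = sym (++-identityʳ (children s))
children-iter s (t ∷ ts) = trans (children-iter (s ∧ t) ts) (++-assoc (children s) (Φ t ∷ []) (map Φ ts))

Φ-iter : ∀ s ts → Φ (iter s ts) ≡ node (children s ++ map Φ ts)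
Φ-iter s ts = trans (Φ≡node∘children (iter s ts)) (cong node (children-iter s ts))

multiDegree-Φ : ∀ s → multiDegree (Φ s) ≡ length (children s) ∷ multiDegreeF (children s)
multiDegree-Φ s = cong multiDegree (Φ≡node∘children s)

multiDegree-Φ-∧ : ∀ s t →
  multiDegree (Φ (s ∧ t)) ≡ suc (length (children s)) ∷ multiDegreeF (children s) ++ multiDegree (Φ t)
multiDegree-Φ-∧ s t = trans (multiDegree-Φ (s ∧ t)) (cong₂ _∷_ length≡ degrees≡)
  where
  length≡ : length (children s ++ Φ t ∷ []) ≡ suc (length (children s))
  length≡ = trans (length-++ (children s)) (+-comm (length (children s)) 1)
  degrees≡ : multiDegreeF (children s ++ Φ t ∷ []) ≡ multiDegreeF (children s) ++ multiDegree (Φ t)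
  degrees≡ = trans (multiDegreeF-++ (children s) (Φ t ∷ []))
                   (cong (multiDegreeF (children s) ++_) (++-identityʳ (multiDegree (Φ t))))

mutual
  Ψ : Plane → Bin
  Ψ (node cs) = iter leaf (Ψs cs)

  Ψs : List Plane → List Bin
  Ψs []       = []
  Ψs (c ∷ cs) = Ψ c ∷ Ψs cs

length-Ψs : ∀ cs → length (Ψs cs) ≡ length cs
length-Ψs []       = refl
length-Ψs (c ∷ cs) = cong suc (length-Ψs cs)

iter-Ψs-++ : ∀ s cs ds → iter s (Ψs (cs ++ ds)) ≡ iter (iter s (Ψs cs)) (Ψs ds)
iter-Ψs-++ s []       ds = refl
iter-Ψs-++ s (c ∷ cs) ds = iter-Ψs-++ (s ∧ Ψ c) cs ds

mutual
  Φ∘Ψ≗id : ∀ p → Φ (Ψ p) ≡ p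
  Φ∘Ψ≗id (node cs) = trans (Φ-iter leaf (Ψs cs)) (cong node (map-Φ-Ψs cs))

  map-Φ-Ψs : ∀ cs → map Φ (Ψs cs) ≡ cs
  map-Φ-Ψs []       = refl
  map-Φ-Ψs (c ∷ cs) = cong₂ _∷_ (Φ∘Ψ≗id c) (map-Φ-Ψs cs)

iter-take-drop : ∀ n s ts → iter s ts ≡ iter (iter s (take n ts)) (drop n ts)
iter-take-drop n s ts = trans (cong (iter s) (sym (take++drop≡id n ts))) (foldl-++ _∧_ s (take n ts) (drop n ts))

module KEquivalence (k : ℕ) {{_ : NonZero k}} where

  infix 4 _≈_
  _≈_ : Bin → Bin → Set
  s ≈ t = s ≈[ k ]ᵇ t

  module ≈-Reasoning = SetoidReasoning (setoid (RightRot k))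

  congMod-isEquivalence : IsEquivalence (CongMod k)
  congMod-isEquivalence = Pointwise.isEquivalence (On.isEquivalence (_% k) isEquivalence)

  open IsEquivalence congMod-isEquivalence using ()
    renaming (refl to congMod-refl; sym to congMod-sym; trans to congMod-trans)

  suc-%-cong : ∀ {a b} → a % k ≡ b % k → suc a % k ≡ suc b % k
  suc-%-cong {a} {b} a≡b = begin
    suc a % k               ≡⟨ %-distribˡ-+ 1 a k ⟩
    (1 % k + a % k) % k     ≡⟨ cong (λ x → (1 % k + x) % k) a≡b ⟩
    (1 % k + b % k) % k     ≡⟨ %-distribˡ-+ 1 b k ⟨
    suc b % k               ∎
    where open ≡-Reasoning

  congMod-shift : ∀ a b xs ys → CongMod k ((a + k) ∷ xs ++ b ∷ ys) (a ∷ xs ++ (b + k) ∷ ys)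
  congMod-shift a b xs ys =
    [m+n]%n≡m%n a k ∷ Pointwise.++⁺ congMod-refl (sym ([m+n]%n≡m%n b k) ∷ congMod-refl)

  moveChildren-congMod : ∀ A B M → length M ≡ k →
    CongMod k (multiDegree (node (A ++ node B ∷ M))) (multiDegree (node (A ++ node (B ++ M) ∷ [])))
  moveChildren-congMod A B M |M|≡k =
    subst₂ (CongMod k) (sym before) (sym after)
      (congMod-shift (suc (length A)) (length B) (multiDegreeF A) (multiDegreeF B ++ multiDegreeF M))
    where
    before : multiDegree (node (A ++ node B ∷ M))
           ≡ (suc (length A) + k) ∷ multiDegreeF A ++ length B ∷ multiDegreeF B ++ multiDegreeF M
    before = cong₂ _∷_
      (trans (length-++ A) (trans (+-suc (length A) (length M)) (cong (λ m → suc (length A + m)) |M|≡k)))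
      (multiDegreeF-++ A (node B ∷ M))
    after : multiDegree (node (A ++ node (B ++ M) ∷ []))
          ≡ suc (length A) ∷ multiDegreeF A ++ (length B + k) ∷ multiDegreeF B ++ multiDegreeF M
    after = cong₂ _∷_
      (trans (length-++ A) (+-comm (length A) 1))
      (trans (multiDegreeF-++ A (node (B ++ M) ∷ []))
        (cong (multiDegreeF A ++_)
          (trans (++-identityʳ _)
            (cong₂ _∷_ (trans (length-++ B) (cong (length B +_) |M|≡k)) (multiDegreeF-++ B M)))))

  ∧ˡ-congMod : ∀ {s s′} t → CongMod k (multiDegree (Φ s)) (multiDegree (Φ s′)) →
    CongMod k (multiDegree (Φ (s ∧ t))) (multiDegree (Φ (s′ ∧ t)))
  ∧ˡ-congMod {s} {s′} t h =
    subst₂ (CongMod k) (sym (multiDegree-Φ-∧ s t)) (sym (multiDegree-Φ-∧ s′ t))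
      (rootStep (subst₂ (CongMod k) (multiDegree-Φ s) (multiDegree-Φ s′) h))
    where
    rootStep : ∀ {d d′ ds ds′} → CongMod k (d ∷ ds) (d′ ∷ ds′) →
      CongMod k (suc d ∷ ds ++ multiDegree (Φ t)) (suc d′ ∷ ds′ ++ multiDegree (Φ t))
    rootStep (d≡d′ ∷ ds≡ds′) = suc-%-cong d≡d′ ∷ Pointwise.++⁺ ds≡ds′ congMod-refl

  ∧ʳ-congMod : ∀ s {t t′} → CongMod k (multiDegree (Φ t)) (multiDegree (Φ t′)) →
    CongMod k (multiDegree (Φ (s ∧ t))) (multiDegree (Φ (s ∧ t′)))
  ∧ʳ-congMod s {t} {t′} h =
    subst₂ (CongMod k) (sym (multiDegree-Φ-∧ s t)) (sym (multiDegree-Φ-∧ s t′))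
      (refl ∷ Pointwise.++⁺ congMod-refl h)

  rightRot⇒congMod : ∀ {s t} → RightRot k s t → CongMod k (multiDegree (Φ s)) (multiDegree (Φ t))
  rightRot⇒congMod (root t₀ [] u _) = congMod-refl
  rightRot⇒congMod (root t₀ (t₁ ∷ ts) u |t₁∷ts|≡k) =
    subst₂ (CongMod k) (cong multiDegree (sym before)) (cong multiDegree (sym after))
      (moveChildren-congMod A B M |M|≡k)
    where
    A = children t₀
    B = children t₁
    M = map Φ (ts ∷ʳ u)
    |M|≡k : length M ≡ k
    |M|≡k = trans (length-map Φ (ts ∷ʳ u)) (trans (length-++ ts) (trans (+-comm (length ts) 1) |t₁∷ts|≡k))
    before : Φ (iter t₀ (t₁ ∷ ts) ∧ u) ≡ node (A ++ node B ∷ M)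
    before = trans (cong Φ (sym (foldl-∷ʳ _∧_ t₀ u (t₁ ∷ ts))))
               (trans (Φ-iter t₀ (t₁ ∷ ts ∷ʳ u)) (cong (λ c → node (A ++ c ∷ M)) (Φ≡node∘children t₁)))
    after : Φ (t₀ ∧ iter t₁ (ts ∷ʳ u)) ≡ node (A ++ node (B ++ M) ∷ [])
    after = trans (Φ≡node∘children (t₀ ∧ iter t₁ (ts ∷ʳ u)))
              (cong (λ c → node (A ++ c ∷ [])) (Φ-iter t₁ (ts ∷ʳ u)))
  rightRot⇒congMod (left {s} {s′} t r) = ∧ˡ-congMod {s} {s′} t (rightRot⇒congMod r)
  rightRot⇒congMod (right {t} {t′} s r) = ∧ʳ-congMod s {t} {t′} (rightRot⇒congMod r)

  ≈⇒congMod : ∀ {s t} → s ≈ t → CongMod k (multiDegree (Φ s)) (multiDegree (Φ t))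
  ≈⇒congMod = gfold congMod-isEquivalence (multiDegree ∘ Φ) rightRot⇒congMod

  ∧-congʳ : ∀ s {t t′} → t ≈ t′ → s ∧ t ≈ s ∧ t′
  ∧-congʳ s = gmap (s ∧_) (right s)

  iter-congˡ : ∀ {s s′} ts → s ≈ s′ → iter s ts ≈ iter s′ ts
  iter-congˡ []       s≈s′ = s≈s′
  iter-congˡ (t ∷ ts) s≈s′ = iter-congˡ ts (gmap (_∧ t) (left t) s≈s′)

  rightRot-iter : ∀ t₀ t₁ ts → length ts ≡ k → RightRot k (iter (t₀ ∧ t₁) ts) (t₀ ∧ iter t₁ ts)
  rightRot-iter t₀ t₁ ts |ts|≡k with initLast ts
  ... | []       = ⊥-elim (≢-nonZero⁻¹ k (sym |ts|≡k))
  ... | ys ∷ʳ′ y =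
    subst (λ s → RightRot k s (t₀ ∧ iter t₁ (ys ∷ʳ y))) (sym (foldl-∷ʳ _∧_ (t₀ ∧ t₁) y ys))
      (root t₀ (t₁ ∷ ys) y (trans (+-comm 1 (length ys)) (trans (sym (length-++ ys)) |ts|≡k)))

  -- m left rotations, one per block of k trees of ts.
  ∧-iter-reassoc : ∀ m s t ts → length ts ≡ m * k → s ∧ iter t ts ≈ iter (s ∧ t) ts
  ∧-iter-reassoc zero    s t []  _ = ε
  ∧-iter-reassoc (suc m) s t ts |ts|≡ = begin
    s ∧ iter t ts                       ≡⟨ cong (s ∧_) (iter-take-drop k t ts) ⟩
    s ∧ iter (iter t (take k ts)) rest  ≈⟨ ∧-iter-reassoc m s (iter t (take k ts)) rest |rest|≡ ⟩
    iter (s ∧ iter t (take k ts)) rest  ≈⟨ iter-congˡ rest (bwd (rightRot-iter s t (take k ts) |take|≡k) ◅ ε) ⟩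
    iter (iter (s ∧ t) (take k ts)) rest ≡⟨ iter-take-drop k (s ∧ t) ts ⟨
    iter (s ∧ t) ts                     ∎
    where
    open ≈-Reasoning
    rest = drop k ts
    |take|≡k : length (take k ts) ≡ k
    |take|≡k = trans (length-take k ts) (m≤n⇒m⊓n≡m (subst (k ≤_) (sym |ts|≡) (m≤m+n k (m * k))))
    |rest|≡ : length rest ≡ m * k
    |rest|≡ = trans (length-drop k ts) (trans (cong (_∸ k) |ts|≡) (m+n∸m≡n k (m * k)))

  spill : Plane → List Plane
  spill (node cs) = node (take (length cs % k) cs) ∷ drop (length cs % k) cs

  mutual
    normal : Plane → Plane
    normal (node cs) = node (normalF cs)

    normalF : List Plane → List Plane
    normalF []       = []
    normalF (c ∷ cs) = spill (normal c) ++ normalF cs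

  ∧-Ψ≈spill : ∀ s p → s ∧ Ψ p ≈ iter s (Ψs (spill p))
  ∧-Ψ≈spill s (node cs) = begin
    s ∧ Ψ (node cs)                  ≡⟨ cong (λ xs → s ∧ Ψ (node xs)) (take++drop≡id r cs) ⟨
    s ∧ iter leaf (Ψs (kept ++ moved)) ≡⟨ cong (s ∧_) (iter-Ψs-++ leaf kept moved) ⟩
    s ∧ iter (Ψ (node kept)) (Ψs moved) ≈⟨ ∧-iter-reassoc (length cs / k) s (Ψ (node kept)) (Ψs moved) |moved|≡ ⟩
    iter s (Ψs (spill (node cs)))    ∎
    where
    open ≈-Reasoning
    r = length cs % k
    kept = take r cs
    moved = drop r cs
    |moved|≡ : length (Ψs moved) ≡ length cs / k * k
    |moved|≡ = trans (length-Ψs moved) (trans (length-drop r cs)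
      (trans (cong (_∸ r) (m≡m%n+[m/n]*n (length cs) k)) (m+n∸m≡n r (length cs / k * k))))

  mutual
    Ψ≈Ψ∘normal : ∀ p → Ψ p ≈ Ψ (normal p)
    Ψ≈Ψ∘normal (node cs) = iter-Ψs≈normalF leaf cs

    iter-Ψs≈normalF : ∀ s cs → iter s (Ψs cs) ≈ iter s (Ψs (normalF cs))
    iter-Ψs≈normalF s []       = ε
    iter-Ψs≈normalF s (c ∷ cs) = begin
      iter (s ∧ Ψ c) (Ψs cs)            ≈⟨ iter-congˡ (Ψs cs) (∧-congʳ s (Ψ≈Ψ∘normal c)) ⟩
      iter (s ∧ Ψ (normal c)) (Ψs cs)   ≈⟨ iter-congˡ (Ψs cs) (∧-Ψ≈spill s (normal c)) ⟩
      iter s′ (Ψs cs)                   ≈⟨ iter-Ψs≈normalF s′ cs ⟩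
      iter s′ (Ψs (normalF cs))         ≡⟨ iter-Ψs-++ s (spill (normal c)) (normalF cs) ⟨
      iter s (Ψs (spill (normal c) ++ normalF cs)) ∎
      where
      open ≈-Reasoning
      s′ = iter s (Ψs (spill (normal c)))

  congMod-normal : ∀ p → CongMod k (multiDegree p) (multiDegree (normal p))
  congMod-normal p =
    subst₂ (CongMod k) (cong multiDegree (Φ∘Ψ≗id p)) (cong multiDegree (Φ∘Ψ≗id (normal p)))
      (≈⇒congMod (Ψ≈Ψ∘normal p))

  multiDegreeF-spill : ∀ cs → multiDegreeF (spill (node cs)) ≡ length cs % k ∷ multiDegreeF cs
  multiDegreeF-spill cs = cong₂ _∷_
    (trans (length-take r cs) (m≤n⇒m⊓n≡m (m%n≤m (length cs) k)))
    (trans (sym (multiDegreeF-++ (take r cs) (drop r cs))) (cong multiDegreeF (take++drop≡id r cs)))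
    where r = length cs % k

  nodesF-spill : ∀ p → nodesF (spill p) ≡ nodes p
  nodesF-spill (node cs) =
    cong suc (trans (sym (nodesF-++ (take r cs) (drop r cs))) (cong nodesF (take++drop≡id r cs)))
    where r = length cs % k

  nodesF-normalF : ∀ cs → nodesF (normalF cs) ≡ nodesF cs
  nodesF-normalF []              = refl
  nodesF-normalF (node cs′ ∷ cs) =
    trans (nodesF-++ (spill (normal (node cs′))) (normalF cs))
      (cong₂ _+_ (trans (nodesF-spill (normal (node cs′))) (cong suc (nodesF-normalF cs′)))
                 (nodesF-normalF cs))

  normalF-degrees<k : ∀ cs → All (_< k) (multiDegreeF (normalF cs))
  normalF-degrees<k []              = []
  normalF-degrees<k (node cs′ ∷ cs) =
    subst (All (_< k)) (sym (multiDegreeF-++ (spill (normal (node cs′))) (normalF cs)))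
      (++⁺ (subst (All (_< k)) (sym (multiDegreeF-spill (normalF cs′)))
              (m%n<n _ k ∷ normalF-degrees<k cs′))
           (normalF-degrees<k cs))

  congMod-bounded⇒≡ : ∀ {xs ys} → CongMod k xs ys → All (_< k) xs → All (_< k) ys → xs ≡ ys
  congMod-bounded⇒≡ []              []         []         = refl
  congMod-bounded⇒≡ (x≡y ∷ xs≡ys) (x<k ∷ xs<k) (y<k ∷ ys<k) =
    cong₂ _∷_ (trans (sym (m<n⇒m%n≡m x<k)) (trans x≡y (m<n⇒m%n≡m y<k))) (congMod-bounded⇒≡ xs≡ys xs<k ys<k)

  normal-unique : ∀ p q → nodes p ≡ nodes q → CongMod k (multiDegree p) (multiDegree q) → normal p ≡ normal q
  normal-unique (node cs) (node ds) nodes≡ p≡q =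
    cong node (multiDegreeF-injective normalNodes≡ normalDegrees≡)
    where
    normalNodes≡ : nodesF (normalF cs) ≡ nodesF (normalF ds)
    normalNodes≡ = trans (nodesF-normalF cs) (trans (suc-injective nodes≡) (sym (nodesF-normalF ds)))
    normalDegrees≡ : multiDegreeF (normalF cs) ≡ multiDegreeF (normalF ds)
    normalDegrees≡ with congMod-trans (congMod-sym (congMod-normal (node cs)))
                          (congMod-trans p≡q (congMod-normal (node ds)))
    ... | _ ∷ tails = congMod-bounded⇒≡ tails (normalF-degrees<k cs) (normalF-degrees<k ds)

  congMod⇒≈ : ∀ p q → nodes p ≡ nodes q → CongMod k (multiDegree p) (multiDegree q) → Ψ p ≈ Ψ q
  congMod⇒≈ p q nodes≡ p≡q = begin
    Ψ p          ≈⟨ Ψ≈Ψ∘normal p ⟩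
    Ψ (normal p) ≡⟨ cong Ψ (normal-unique p q nodes≡ p≡q) ⟩
    Ψ (normal q) ≈⟨ Ψ≈Ψ∘normal q ⟨
    Ψ q          ∎
    where open ≈-Reasoning

  ≈ᵖ⇒congMod : ∀ {p q} → p ≈[ k ]ᵖ q → CongMod k (multiDegree p) (multiDegree q)
  ≈ᵖ⇒congMod (_ , _ , refl , refl , s≈t) = ≈⇒congMod s≈t

proposition2p10 : (k n : ℕ) → (1≤k : 1 ≤ k) → (p q : Plane) →
    nodes p ≡ suc n → nodes q ≡ suc n →
    (p ≈[ k ]ᵖ q) ⇔ CongMod k {{>-nonZero 1≤k}} (multiDegree p) (multiDegree q)
proposition2p10 k n 1≤k p q |p|≡ |q|≡ = mk⇔ ≈ᵖ⇒congMod
  (λ p≡q → Ψ p , Ψ q , Φ∘Ψ≗id p , Φ∘Ψ≗id q , congMod⇒≈ p q (trans |p|≡ (sym |q|≡)) p≡q)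
  where open KEquivalence k {{>-nonZero 1≤k}}
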